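{- For every set of formulas $\Gamma$ and formula $\varphi$: if $\Gamma\vdash_{\mathsf{CK}}\varphi$ then $\Gamma\Vdash_{\mathcal{CK}}\varphi$, where $\mathcal{CK}$ is the class of all CK-frames.
   Context: Formulas are built from a countably infinite set of propositional variables by $\varphi ::= p \mid \bot \mid \varphi\wedge\varphi \mid \varphi\vee\varphi \mid \varphi\to\varphi \mid \Box\varphi \mid \Diamond\varphi$. $\Gamma\vdash_{\mathsf{CK}}\varphi$ is the consequence relation generated by: (Ax) $\Gamma\vdash\varphi$ whenever $\varphi$ is a substitution instance of an axiom of a standard Hilbert axiomatisation of intuitionistic propositional logic, of $\Box(p\to q)\to(\Box p\to\Box q)$, or of $\Box(p\to q)\to(\Diamond p\to\Diamond q)$; (El) $\Gamma\vdash\varphi$ if $\varphi\in\Gamma$; (MP) from $\Gamma\vdash\varphi$ and $\Gamma\vdash\varphi\to\psi$ infer $\Gamma\vdash\psi$; (Nec) from $\emptyset\vdash\varphi$ infer $\Gamma\vdash\Box\varphi$. A CK-frame is $(X,e,\le,R)$ with $(X,\le)$ a preorder, $e\in X$ such that $e\le y$ implies $y=e$, and $R\subseteq X\times X$ such that $eRx$ iff $x=e$. A valuation maps each variable to an upset of $(X,\le)$ containing $e$. Forcing: $x\Vdash p$ iff $x\in V(p)$; $x\Vdash\bot$ iff $x=e$; $\wedge,\vee$ pointwise; $x\Vdash\varphi\to\psi$ iff for all $y\ge x$, $y\Vdash\varphi$ implies $y\Vdash\psi$; $x\Vdash\Box\varphi$ iff for all $y,z$ with $x\le y$ and $yRz$,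 $z\Vdash\varphi$; $x\Vdash\Diamond\varphi$ iff for all $y\ge x$ there is $z$ with $yRz$ and $z\Vdash\varphi$. A frame validates $\Gamma\vdash\varphi$ if for every valuation, every world forcing all of $\Gamma$ forces $\varphi$. For a class $\mathcal F$ of CK-frames, $\Gamma\Vdash_{\mathcal F}\varphi$ means every frame in $\mathcal F$ validates $\Gamma\vdash\varphi$. -}

module Defs where

open import Data.Nat using (ℕ)
open import Data.Empty using (⊥)
open import Data.Product using (Σ; _×_; ∃)
open import Data.Sum using (_⊎_)
open import Relation.Binary.PropositionalEquality using (_≡_)

data Fm : Set where
  var  : ℕ → Fm
  ⊥'   : Fm
  _∧'_ : Fm → Fm → Fm
  _∨'_ : Fm → Fm → Fm
  _⇒_  : Fm → Fm → Fm
  □    : Fm → Fm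
  ◇    : Fm → Fm

infixr 5 _⇒_
infixl 7 _∧'_
infixl 6 _∨'_

Subst : Set
Subst = ℕ → Fm

sub : Subst → Fm → Fm
sub σ (var n)  = σ n
sub σ ⊥'       = ⊥'
sub σ (a ∧' b) = sub σ a ∧' sub σ b
sub σ (a ∨' b) = sub σ a ∨' sub σ b
sub σ (a ⇒ b)  = sub σ a ⇒ sub σ b
sub σ (□ a)    = □ (sub σ a)
sub σ (◇ a)    = ◇ (sub σ a)

p q r : Fm
p = var 0
q = var 1
r = var 2

data Axiom : Fm → Set where
  ax-K    : Axiom (p ⇒ (q ⇒ p))
  ax-S    : Axiom ((p ⇒ (q ⇒ r)) ⇒ ((p ⇒ q) ⇒ (p ⇒ r)))
  ax-∧E₁  : Axiom ((p ∧' q) ⇒ p)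
  ax-∧E₂  : Axiom ((p ∧' q) ⇒ q)
  ax-∧I   : Axiom (p ⇒ (q ⇒ (p ∧' q)))
  ax-∨I₁  : Axiom (p ⇒ (p ∨' q))
  ax-∨I₂  : Axiom (q ⇒ (p ∨' q))
  ax-∨E   : Axiom ((p ⇒ r) ⇒ ((q ⇒ r) ⇒ ((p ∨' q) ⇒ r)))
  ax-⊥E   : Axiom (⊥' ⇒ p)
  ax-□K   : Axiom (□ (p ⇒ q) ⇒ (□ p ⇒ □ q))
  ax-◇K   : Axiom (□ (p ⇒ q) ⇒ (◇ p ⇒ ◇ q))

FmSet : Set₁
FmSet = Fm → Set

∅ : FmSet
∅ _ = ⊥

data _⊢_ (Γ : FmSet) : Fm → Set₁ where
  Ax  : ∀ {φ} (σ : Subst) (a : Fm) → Axiom a → sub σ a ≡ φ → Γ ⊢ φ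
  El  : ∀ {φ} → Γ φ → Γ ⊢ φ
  MP  : ∀ {φ ψ} → Γ ⊢ φ → Γ ⊢ (φ ⇒ ψ) → Γ ⊢ ψ
  Nec : ∀ {φ} → ∅ ⊢ φ → Γ ⊢ □ φ

record CKFrame : Set₁ where
  field
    X      : Set
    e      : X
    _≤_    : X → X → Set
    R      : X → X → Set
    ≤-refl  : ∀ {x} → x ≤ x
    ≤-trans : ∀ {x y z} → x ≤ y → y ≤ z → x ≤ z
    e-top   : ∀ {y} → e ≤ y → y ≡ e
    R-e⇒    : ∀ {x} → R e x → x ≡ e
    R-e⇐    : ∀ {x} → x ≡ e → R e x

record Valuation (F : CKFrame) : Set₁ where
  open CKFrame F
  field
    V      : ℕ → X → Set
    V-up   : ∀ {n x y} → x ≤ y → V n x → V n y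
    V-e    : ∀ n → V n e

module _ (F : CKFrame) (M : Valuation F) where
  open CKFrame F
  open Valuation M

  _⊩_ : X → Fm → Set
  x ⊩ var n  = V n x
  x ⊩ ⊥'     = x ≡ e
  x ⊩ (a ∧' b) = (x ⊩ a) × (x ⊩ b)
  x ⊩ (a ∨' b) = (x ⊩ a) ⊎ (x ⊩ b)
  x ⊩ (a ⇒ b)  = ∀ y → x ≤ y → y ⊩ a → y ⊩ b
  x ⊩ □ a      = ∀ y z → x ≤ y → R y z → z ⊩ a
  x ⊩ ◇ a      = ∀ y → x ≤ y → Σ X (λ z → R y z × (z ⊩ a))

Validates : CKFrame → FmSet → Fm → Set₁
Validates F Γ φ = (M : Valuation F) (x : CKFrame.X F) →
  (∀ ψ → Γ ψ → _⊩_ F M x ψ) → _⊩_ F M x φ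

_⊩CK_ : FmSet → Fm → Set₁
Γ ⊩CK φ = (F : CKFrame) → Validates F Γ φ

{-# OPTIONS --safe #-}
-- Two properties of forcing do
-- the work: persistence along ≤ (needed for the instances of K and ∧I), and the
-- fact that the fallible world e forces every formula (needed for ⊥E, since
-- x ⊩ ⊥ means x ≡ e). Necessitation is sound because its premise is derived
-- from ∅ and therefore forced at every world, in particular at every R-successor.
module Submission where

open import Defs
open import Data.Product using (_,_)
open import Data.Sum using (inj₁; inj₂)
open import Relation.Binary.PropositionalEquality using (refl; sym; subst)

module Forcing (F : CKFrame) (M : Valuation F) where
  open CKFrame F
  open Valuation M

  _⊨_ : X → Fm → Set
  _⊨_ = _⊩_ F M

  ⊩-mono : ∀ φ {x y} → x ≤ y → x ⊨ φ → y ⊨ φ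
  ⊩-mono (var n)  x≤y x⊩n             = V-up x≤y x⊩n
  ⊩-mono ⊥'       x≤y refl            = e-top x≤y
  ⊩-mono (φ ∧' ψ) x≤y (x⊩φ , x⊩ψ)     = ⊩-mono φ x≤y x⊩φ , ⊩-mono ψ x≤y x⊩ψ
  ⊩-mono (φ ∨' ψ) x≤y (inj₁ x⊩φ)      = inj₁ (⊩-mono φ x≤y x⊩φ)
  ⊩-mono (φ ∨' ψ) x≤y (inj₂ x⊩ψ)      = inj₂ (⊩-mono ψ x≤y x⊩ψ)
  ⊩-mono (φ ⇒ ψ)  x≤y x⊩φ⇒ψ z y≤z     = x⊩φ⇒ψ z (≤-trans x≤y y≤z)
  ⊩-mono (□ φ)    x≤y x⊩□φ z w y≤z    = x⊩□φ z w (≤-trans x≤y y≤z)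
  ⊩-mono (◇ φ)    x≤y x⊩◇φ z y≤z      = x⊩◇φ z (≤-trans x≤y y≤z)

  e-⊩ : ∀ φ → e ⊨ φ
  e-⊩ (var n)  = V-e n
  e-⊩ ⊥'       = refl
  e-⊩ (φ ∧' ψ) = e-⊩ φ , e-⊩ ψ
  e-⊩ (φ ∨' ψ) = inj₁ (e-⊩ φ)
  e-⊩ (φ ⇒ ψ) y e≤y _ = subst (_⊨ ψ) (sym (e-top e≤y)) (e-⊩ ψ)
  e-⊩ (□ φ) y z e≤y yRz =
    subst (_⊨ φ) (sym (R-e⇒ (subst (λ t → R t z) (e-top e≤y) yRz))) (e-⊩ φ)
  e-⊩ (◇ φ) y e≤y = e , subst (λ t → R t e) (sym (e-top e≤y)) (R-e⇐ refl) , e-⊩ φ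

  ⊥-⊩ : ∀ φ {x} → x ⊨ ⊥' → x ⊨ φ
  ⊥-⊩ φ refl = e-⊩ φ

  axiom-⊩ : ∀ σ {a} → Axiom a → ∀ x → x ⊨ sub σ a
  axiom-⊩ σ ax-K   _ y _ y⊩p z y≤z _ = ⊩-mono (σ 0) y≤z y⊩p
  axiom-⊩ σ ax-S   _ _ _ y⊩p⇒q⇒r z y≤z z⊩p⇒q w z≤w w⊩p =
    y⊩p⇒q⇒r w (≤-trans y≤z z≤w) w⊩p w ≤-refl (z⊩p⇒q w z≤w w⊩p)
  axiom-⊩ σ ax-∧E₁ _ _ _ (y⊩p , _)   = y⊩p
  axiom-⊩ σ ax-∧E₂ _ _ _ (_ , y⊩q)   = y⊩q
  axiom-⊩ σ ax-∧I  _ _ _ y⊩p z y≤z z⊩q = ⊩-mono (σ 0) y≤z y⊩p , z⊩q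
  axiom-⊩ σ ax-∨I₁ _ _ _ y⊩p = inj₁ y⊩p
  axiom-⊩ σ ax-∨I₂ _ _ _ y⊩q = inj₂ y⊩q
  axiom-⊩ σ ax-∨E  _ _ _ y⊩p⇒r z y≤z _ w z≤w (inj₁ w⊩p) = y⊩p⇒r w (≤-trans y≤z z≤w) w⊩p
  axiom-⊩ σ ax-∨E  _ _ _ _ _ _ z⊩q⇒r w z≤w (inj₂ w⊩q) = z⊩q⇒r w z≤w w⊩q
  axiom-⊩ σ ax-⊥E  _ _ _ y⊩⊥ = ⊥-⊩ (σ 0) y⊩⊥
  axiom-⊩ σ ax-□K  _ _ _ y⊩□[p⇒q] z y≤z z⊩□p u v z≤u uRv =
    y⊩□[p⇒q] u v (≤-trans y≤z z≤u) uRv v ≤-refl (z⊩□p u v z≤u uRv)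
  axiom-⊩ σ ax-◇K  _ _ _ y⊩□[p⇒q] z y≤z z⊩◇p u z≤u
    with z⊩◇p u z≤u
  ... | v , uRv , v⊩p = v , uRv , y⊩□[p⇒q] u v (≤-trans y≤z z≤u) uRv v ≤-refl v⊩p

soundness : ∀ {Γ φ} → Γ ⊢ φ → Γ ⊩CK φ
soundness (Ax σ _ a refl) F M x _   = Forcing.axiom-⊩ F M σ a x
soundness (El φ∈Γ)        F M x x⊩Γ = x⊩Γ _ φ∈Γ
soundness (MP ⊢φ ⊢φ⇒ψ)    F M x x⊩Γ =
  soundness ⊢φ⇒ψ F M x x⊩Γ x (CKFrame.≤-refl F) (soundness ⊢φ F M x x⊩Γ)
soundness (Nec ⊢φ)        F M _ _ _ z _ _ = soundness ⊢φ F M z (λ _ ())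

mainTheorem6 : (Γ : FmSet) (φ : Fm) → Γ ⊢ φ → Γ ⊩CK φ
mainTheorem6 _ _ = soundness
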